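{- Let $k:L\to kL$ be a compactification of a locale $L$. Then there exist a sub-pcd-lattice $P_k$ of $L$ and a strong inclusion $\lhd_k$ on $P_k$ compatible with $L$ such that the locale $\mathcal R(P_k,\lhd_k)$ is isomorphic to $kL$.
   Context: Framework: constructive set theory CZF + RRS-$\bigcup$REA (intuitionistic logic, no Powerset, Restricted Separation only). A locale $(L,B)$ is a class-frame with a set basis $B$ such that every $x$ is the join of the set $\{b\in B:b\le x\}$. $y^*=\bigvee\{c\in B:c\wedge y=0\}$; $y\prec x$ iff $1=x\vee y^*$. Regular: $a=\bigvee\{b\in B:b\prec a\}$ for $a\in B$; compact: every subset of $B$ with join $1$ has a finite subset with join $1$. A continuous map $f:L\to M$ is a function $f^-:B_M\to L$ preserving the top, binary meets in the form $f^-(a)\wedge f^-(b)=\bigvee\{f^-(c):c\in B_M,c\le a,c\le b\}$, and covers; $f^-[a]=\bigvee\{f^-(b):b\in B_M,b\le a\}$. Dense: $f^-[a]=0\Rightarrow a=0$; embedding: $f^-[\cdot]$ onto; a compactification is a dense embedding into a compact regular locale. A sub-pcd-lattice of $L$ is a set closed under finite meets, finite joins and $^*$. A strong inclusion on $P$ is a set-relation $\lhd$ with: (1) $0\lhd0$, $1\lhd1$; (2) $x\le a\lhd b\le y\Rightarrow x\lhd y$; (3) $x\lhd a,x\lhd b\Rightarrow x\lhd a\wedge b$; (4) $x\lhd a,y\lhd a\Rightarrow x\vee y\lhd a$; (5) $a\lhd b\Rightarrow b^*\lhd a^*$; (6) $\lhd\subseteq\prec$; (7) $x\lhd y\Rightarrow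 x\lhd z\lhd y$ for some $z\in P$. It is compatible with $L$ if $L$ is set-generated by $P$ and $a=\bigvee_L\{x\in P:x\lhd a\}$ for all $a\in P$. $\mathcal R(P,\lhd)$ is the locale of round ideals of $P$ (ideals $I$ — downward closed and closed under finite joins — such that each $b\in I$ has $a\in I$ with $b\lhd a$), ordered by inclusion, with basis $\{\Downarrow a:a\in P\}$, $\Downarrow a=\{b\in P:b\lhd a\}$. -}

module Defs where

open import Data.Product using (Σ; Σ-syntax; _×_; _,_; proj₁; proj₂)
open import Data.Nat using (ℕ)
open import Data.Fin using (Fin)
open import Data.Bool using (Bool; true; false)
open import Data.Empty using (⊥)
import Data.Empty as E

-- Class-frames.  "Sets" of CZF are modelled by types in Set, "classes"
-- by types in Set₁.  Joins are taken of set-indexed families.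

record ClassFrame : Set₂ where
  infix 4 _≤_ _≈_
  infixr 7 _∧_
  field
    Carrier : Set₁
    _≤_     : Carrier → Carrier → Set
    ⊤       : Carrier
    _∧_     : Carrier → Carrier → Carrier
    ⋁       : {I : Set} → (I → Carrier) → Carrier
    ≤-refl  : ∀ {x} → x ≤ x
    ≤-trans : ∀ {x y z} → x ≤ y → y ≤ z → x ≤ z
    ⊤-max   : ∀ {x} → x ≤ ⊤
    ∧-lb₁   : ∀ {x y} → x ∧ y ≤ x
    ∧-lb₂   : ∀ {x y} → x ∧ y ≤ y
    ∧-glb   : ∀ {x y z} → z ≤ x → z ≤ y → z ≤ x ∧ y
    ⋁-ub    : ∀ {I : Set} (f : I → Carrier) (i : I) → f i ≤ ⋁ f
    ⋁-lub   : ∀ {I : Set} (f : I → Carrier) {z} → (∀ i → f i ≤ z) → ⋁ f ≤ z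
    distrib : ∀ {I : Set} (x : Carrier) (f : I → Carrier) →
              x ∧ ⋁ f ≤ ⋁ (λ i → x ∧ f i)

  _≈_ : Carrier → Carrier → Set
  x ≈ y = (x ≤ y) × (y ≤ x)

  𝟘 : Carrier
  𝟘 = ⋁ {⊥} E.⊥-elim

  infixr 6 _∨_
  _∨_ : Carrier → Carrier → Carrier
  x ∨ y = ⋁ {Bool} (λ { true → x ; false → y })

record Locale : Set₂ where
  field
    frame : ClassFrame
  open ClassFrame frame public
  field
    B     : Set
    β     : B → Carrier
    basis : ∀ x → x ≈ ⋁ {Σ[ b ∈ B ] (β b ≤ x)} (λ p → β (proj₁ p))

  _* : Carrier → Carrier
  y * = ⋁ {Σ[ c ∈ B ] (β c ∧ y ≈ 𝟘)} (λ p → β (proj₁ p))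

  infix 4 _≺_
  _≺_ : Carrier → Carrier → Set
  y ≺ x = ⊤ ≈ x ∨ (y *)

module _ (L : Locale) where
  open Locale L

  IsRegular : Set
  IsRegular = ∀ (a : B) → β a ≈ ⋁ {Σ[ b ∈ B ] (β b ≺ β a)} (λ p → β (proj₁ p))

  IsCompact : Set₁
  IsCompact = ∀ (U : B → Set) →
    ⋁ {Σ[ b ∈ B ] U b} (λ p → β (proj₁ p)) ≈ ⊤ →
    Σ[ n ∈ ℕ ] Σ[ g ∈ (Fin n → Σ[ b ∈ B ] U b) ]
      (⋁ {Fin n} (λ i → β (proj₁ (g i))) ≈ ⊤)

-- Continuous maps f : L → M, given by f⁻ : B_M → L.

module _ (L M : Locale) where
  private
    module L = Locale L
    module M = Locale M

  pre[_] : (M.B → L.Carrier) → M.Carrier → L.Carrier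
  pre[ f ] a = L.⋁ {Σ[ b ∈ M.B ] (M.β b M.≤ a)} (λ p → f (proj₁ p))

  record IsContinuous (f : M.B → L.Carrier) : Set₁ where
    field
      pres-top  : pre[ f ] M.⊤ L.≈ L.⊤
      pres-meet : ∀ (a b : M.B) →
        f a L.∧ f b L.≈
          L.⋁ {Σ[ c ∈ M.B ] ((M.β c M.≤ M.β a) × (M.β c M.≤ M.β b))}
              (λ p → f (proj₁ p))
      pres-cover : ∀ (a : M.B) (U : M.B → Set) →
        M.β a M.≤ M.⋁ {Σ[ u ∈ M.B ] U u} (λ p → M.β (proj₁ p)) →
        f a L.≤ L.⋁ {Σ[ u ∈ M.B ] U u} (λ p → f (proj₁ p))

  IsDense : (M.B → L.Carrier) → Set₁
  IsDense f = ∀ (a : M.Carrier) → pre[ f ] a L.≈ L.𝟘 → a M.≈ M.𝟘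

  IsEmbedding : (M.B → L.Carrier) → Set₁
  IsEmbedding f = ∀ (x : L.Carrier) → Σ[ a ∈ M.Carrier ] (pre[ f ] a L.≈ x)

  record IsCompactification (k : M.B → L.Carrier) : Set₁ where
    field
      continuous : IsContinuous k
      dense      : IsDense k
      embedding  : IsEmbedding k
      compact    : IsCompact M
      regular    : IsRegular M

module _ (L : Locale) where
  open Locale L

  record SubPcdLattice : Set₁ where
    field
      P    : Set
      ι    : P → Carrier
      0P 1P : P
      _∧P_ _∨P_ : P → P → P
      _*P  : P → P
      ι-0  : ι 0P ≈ 𝟘
      ι-1  : ι 1P ≈ ⊤
      ι-∧  : ∀ p q → ι (p ∧P q) ≈ ι p ∧ ι q
      ι-∨  : ∀ p q → ι (p ∨P q) ≈ ι p ∨ ι q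
      ι-*  : ∀ p → ι (p *P) ≈ (ι p) *

  module _ (S : SubPcdLattice) where
    open SubPcdLattice S

    record IsStrongInclusion (_◁_ : P → P → Set) : Set₁ where
      field
        si-0 : 0P ◁ 0P
        si-1 : 1P ◁ 1P
        si-mono : ∀ {x a b y} → ι x ≤ ι a → a ◁ b → ι b ≤ ι y → x ◁ y
        si-∧ : ∀ {x a b} → x ◁ a → x ◁ b → x ◁ (a ∧P b)
        si-∨ : ∀ {x y a} → x ◁ a → y ◁ a → (x ∨P y) ◁ a
        si-* : ∀ {a b} → a ◁ b → (b *P) ◁ (a *P)
        si-≺ : ∀ {a b} → a ◁ b → ι a ≺ ι b
        si-interp : ∀ {x y} → x ◁ y → Σ[ z ∈ P ] ((x ◁ z) × (z ◁ y))

    record IsCompatible (_◁_ : P → P → Set) : Set₁ where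
      field
        generates : ∀ (x : Carrier) →
          x ≈ ⋁ {Σ[ p ∈ P ] (ι p ≤ x)} (λ q → ι (proj₁ q))
        approx : ∀ (a : P) →
          ι a ≈ ⋁ {Σ[ x ∈ P ] (x ◁ a)} (λ q → ι (proj₁ q))

    record RoundIdeal (_◁_ : P → P → Set) : Set₁ where
      field
        I      : P → Set
        down   : ∀ {p q} → ι q ≤ ι p → I p → I q
        has-0  : I 0P
        has-∨  : ∀ {p q} → I p → I q → I (p ∨P q)
        round  : ∀ {b} → I b → Σ[ a ∈ P ] (I a × (b ◁ a))

-- Isomorphism of the locale ℛ(P,◁) with a locale M: an isomorphism of the
-- underlying frames, i.e. an order isomorphism between round ideals
-- (ordered by inclusion) and the carrier of M.

module _ (L : Locale) (S : SubPcdLattice L) (_◁_ : SubPcdLattice.P S → SubPcdLattice.P S → Set)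
         (M : Locale) where
  open SubPcdLattice S
  private module M = Locale M

  _⊆R_ : RoundIdeal L S _◁_ → RoundIdeal L S _◁_ → Set
  I ⊆R J = ∀ p → RoundIdeal.I I p → RoundIdeal.I J p

  record ℛ≅ : Set₁ where
    field
      to   : RoundIdeal L S _◁_ → M.Carrier
      from : M.Carrier → RoundIdeal L S _◁_
      to-mono   : ∀ {I J} → I ⊆R J → to I M.≤ to J
      from-mono : ∀ {x y} → x M.≤ y → from x ⊆R from y
      from-to   : ∀ I → (from (to I) ⊆R I) × (I ⊆R from (to I))
      to-from   : ∀ x → to (from x) M.≈ x

-- The preimage map k[_] of the compactification is a frame surjection onto L
-- that commutes with pseudocomplements (by density and surjectivity), and has
-- a right adjoint k₊.  Take for P_k the k-images of the pcd-terms built from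
-- the basis of kL, and let p ◁ q mean that p is well inside k₊ q in kL.  The
-- round ideals of (P_k, ◁) then correspond to the elements x of kL via
-- x ↦ {p : p ≺ x} and I ↦ ⋁ I: regularity of kL shows that x is recovered,
-- and compactness of kL, which makes ≺ interpolate and turns a well-inside
-- relation into a finite cover, shows that the ideal is recovered.
module Submission where

open import Defs
open import Data.Product using (Σ; Σ-syntax; _×_; _,_; proj₁; proj₂)
open import Data.Bool using (true; false)
open import Data.Maybe using (Maybe; just; nothing; maybe′)
open import Data.Nat using (ℕ; zero; suc)
open import Data.Fin using (Fin; zero; suc)
open import Data.Sum using (_⊎_; inj₁; inj₂)
open import Function using (_∘_)
open import Relation.Binary.PropositionalEquality using (_≡_; refl)

module LocaleProperties (M : Locale) where
  open Locale M

  ⋁-reindex : ∀ {I J : Set} (g : J → Carrier) (r : I → J) → ⋁ (g ∘ r) ≤ ⋁ g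
  ⋁-reindex g r = ⋁-lub (g ∘ r) (⋁-ub g ∘ r)

  ⋁-≤-⋁ : ∀ {I J : Set} (f : I → Carrier) (g : J → Carrier) →
          (∀ i → Σ[ j ∈ J ] (f i ≤ g j)) → ⋁ f ≤ ⋁ g
  ⋁-≤-⋁ f g below = ⋁-lub f λ i → ≤-trans (proj₂ (below i)) (⋁-ub g (proj₁ (below i)))

  ⋁-mono : ∀ {I : Set} {f g : I → Carrier} → (∀ i → f i ≤ g i) → ⋁ f ≤ ⋁ g
  ⋁-mono {f = f} {g} f≤g = ⋁-lub f λ i → ≤-trans (f≤g i) (⋁-ub g i)

  x≤x∨y : ∀ {x y} → x ≤ x ∨ y
  x≤x∨y = ⋁-ub _ true

  y≤x∨y : ∀ {x y} → y ≤ x ∨ y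
  y≤x∨y = ⋁-ub _ false

  ∨-lub : ∀ {x y z} → x ≤ z → y ≤ z → x ∨ y ≤ z
  ∨-lub x≤z y≤z = ⋁-lub _ λ { true → x≤z ; false → y≤z }

  ∨-mono : ∀ {x y x′ y′} → x ≤ x′ → y ≤ y′ → x ∨ y ≤ x′ ∨ y′
  ∨-mono x≤x′ y≤y′ = ∨-lub (≤-trans x≤x′ x≤x∨y) (≤-trans y≤y′ y≤x∨y)

  ∨-comm : ∀ {x y} → x ∨ y ≤ y ∨ x
  ∨-comm = ∨-lub y≤x∨y x≤x∨y

  ∧-mono : ∀ {x y x′ y′} → x ≤ x′ → y ≤ y′ → x ∧ y ≤ x′ ∧ y′
  ∧-mono x≤x′ y≤y′ = ∧-glb (≤-trans ∧-lb₁ x≤x′) (≤-trans ∧-lb₂ y≤y′)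

  ∧-comm : ∀ {x y} → x ∧ y ≤ y ∧ x
  ∧-comm = ∧-glb ∧-lb₂ ∧-lb₁

  𝟘-min : ∀ {x} → 𝟘 ≤ x
  𝟘-min = ⋁-lub _ λ ()

  ∧-distribˡ-∨ : ∀ {x y z} → x ∧ (y ∨ z) ≤ (x ∧ y) ∨ (x ∧ z)
  ∧-distribˡ-∨ {x} = ≤-trans (distrib x _) (⋁-lub _ λ { true → x≤x∨y ; false → y≤x∨y })

  ∨-distribʳ-∧ : ∀ {x y z} → (x ∨ z) ∧ (y ∨ z) ≤ (x ∧ y) ∨ z
  ∨-distribʳ-∧ = ≤-trans ∧-distribˡ-∨ (∨-lub
    (≤-trans ∧-comm (≤-trans ∧-distribˡ-∨ (∨-mono ∧-comm ∧-lb₂)))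
    (≤-trans ∧-lb₂ y≤x∨y))

  ⋁-∧-⋁-lub : ∀ {I J : Set} (f : I → Carrier) (g : J → Carrier) {z} →
              (∀ i j → f i ∧ g j ≤ z) → ⋁ f ∧ ⋁ g ≤ z
  ⋁-∧-⋁-lub f g {z} below = ≤-trans (distrib (⋁ f) g) (⋁-lub _ λ j →
    ≤-trans ∧-comm (≤-trans (distrib (g j) f) (⋁-lub _ λ i →
      ≤-trans ∧-comm (below i j))))

  ≤-⋁basis : ∀ x → x ≤ ⋁ {Σ[ b ∈ B ] (β b ≤ x)} (β ∘ proj₁)
  ≤-⋁basis x = proj₁ (basis x)

  ∧≤𝟘⇒≤* : ∀ {x y} → x ∧ y ≤ 𝟘 → x ≤ y *
  ∧≤𝟘⇒≤* {x} x∧y≤𝟘 = ≤-trans (≤-⋁basis x) (⋁-lub _ λ b →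
    ⋁-ub (β ∘ proj₁) (proj₁ b , ≤-trans (∧-mono (proj₂ b) ≤-refl) x∧y≤𝟘 , 𝟘-min))

  x∧x*≤𝟘 : ∀ {x} → x ∧ x * ≤ 𝟘
  x∧x*≤𝟘 {x} = ≤-trans (distrib x _) (⋁-lub _ λ c → ≤-trans ∧-comm (proj₁ (proj₂ c)))

  *-antitone : ∀ {x y} → x ≤ y → y * ≤ x *
  *-antitone x≤y = ∧≤𝟘⇒≤* (≤-trans (∧-mono ≤-refl x≤y) (≤-trans ∧-comm x∧x*≤𝟘))

  x≤x** : ∀ {x} → x ≤ x * *
  x≤x** = ∧≤𝟘⇒≤* x∧x*≤𝟘

  x*∧y*≤[x∨y]* : ∀ {x y} → x * ∧ y * ≤ (x ∨ y) *
  x*∧y*≤[x∨y]* = ∧≤𝟘⇒≤* (≤-trans ∧-distribˡ-∨ (∨-lub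
    (≤-trans (∧-mono ∧-lb₁ ≤-refl) (≤-trans ∧-comm x∧x*≤𝟘))
    (≤-trans (∧-mono ∧-lb₂ ≤-refl) (≤-trans ∧-comm x∧x*≤𝟘))))

  ⊤≤x∨y*⇒y≺x : ∀ {x y} → ⊤ ≤ x ∨ y * → y ≺ x
  ⊤≤x∨y*⇒y≺x ⊤≤x∨y* = ⊤≤x∨y* , ⊤-max

  ≺⇒≤ : ∀ {x y} → y ≺ x → y ≤ x
  ≺⇒≤ y≺x = ≤-trans (∧-glb ≤-refl (≤-trans ⊤-max (proj₁ y≺x)))
    (≤-trans ∧-distribˡ-∨ (∨-lub ∧-lb₂ (≤-trans x∧x*≤𝟘 𝟘-min)))

  ≺-mono : ∀ {x y x′ y′} → y′ ≤ y → y ≺ x → x ≤ x′ → y′ ≺ x′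
  ≺-mono y′≤y y≺x x≤x′ = ⊤≤x∨y*⇒y≺x (≤-trans (proj₁ y≺x) (∨-mono x≤x′ (*-antitone y′≤y)))

  𝟘≺ : ∀ {x} → 𝟘 ≺ x
  𝟘≺ = ⊤≤x∨y*⇒y≺x (≤-trans (∧≤𝟘⇒≤* ∧-lb₂) y≤x∨y)

  ≺⊤ : ∀ {x} → x ≺ ⊤
  ≺⊤ = ⊤≤x∨y*⇒y≺x x≤x∨y

  ≺-∧ : ∀ {x y z} → z ≺ x → z ≺ y → z ≺ x ∧ y
  ≺-∧ z≺x z≺y = ⊤≤x∨y*⇒y≺x (≤-trans (∧-glb (proj₁ z≺x) (proj₁ z≺y)) ∨-distribʳ-∧)

  ≺-∨ : ∀ {x y z} → x ≺ z → y ≺ z → x ∨ y ≺ z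
  ≺-∨ x≺z y≺z = ⊤≤x∨y*⇒y≺x (≤-trans
    (∧-glb (≤-trans (proj₁ x≺z) ∨-comm) (≤-trans (proj₁ y≺z) ∨-comm))
    (≤-trans ∨-distribʳ-∧ (∨-lub (≤-trans x*∧y*≤[x∨y]* y≤x∨y) x≤x∨y)))

  ≺-** : ∀ {x y} → y ≺ x → y * * ≺ x
  ≺-** y≺x = ⊤≤x∨y*⇒y≺x (≤-trans (proj₁ y≺x) (∨-mono ≤-refl x≤x**))

  ≺-* : ∀ {x y} → y ≺ x → x * ≺ y *
  ≺-* y≺x = ⊤≤x∨y*⇒y≺x (≤-trans (proj₁ y≺x) (≤-trans (∨-mono x≤x** ≤-refl) ∨-comm))

  regular⇒≤⋁≺ : IsRegular M → ∀ x → x ≤ ⋁ {Σ[ d ∈ B ] (β d ≺ x)} (β ∘ proj₁)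
  regular⇒≤⋁≺ regular x = ≤-trans (≤-⋁basis x) (⋁-lub _ λ b →
    ≤-trans (proj₁ (regular (proj₁ b)))
      (⋁-reindex (β ∘ proj₁) λ d → proj₁ d , ≺-mono ≤-refl (proj₂ d) (proj₂ b)))

  -- Covering ⊤ = ⋁ f ∨ a* by basic elements and extracting a finite subcover;
  -- the subcover elements lying under a* are recorded as nothing.
  compact⇒≺-⋁-finite : IsCompact M → ∀ {I : Set} (f : I → Carrier) {a} → a ≺ ⋁ f →
    Σ[ n ∈ ℕ ] Σ[ g ∈ (Fin n → Maybe I) ] (a ≺ ⋁ {Fin n} (maybe′ f 𝟘 ∘ g))
  compact⇒≺-⋁-finite compact {I} f {a} a≺⋁f =
    n , tag ∘ g , ⊤≤x∨y*⇒y≺x (≤-trans (proj₂ (proj₂ (proj₂ subcover)))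
                                     (⋁-lub _ λ j → ≤-trans (under-tag (g j))
                                                     (∨-mono (⋁-ub _ j) ≤-refl)))
    where
    U : B → Set
    U b = (β b ≤ a *) ⊎ (Σ[ i ∈ I ] (β b ≤ f i))

    covers : ⋁ {Σ[ b ∈ B ] U b} (β ∘ proj₁) ≈ ⊤
    covers = ⊤-max , ≤-trans (proj₁ a≺⋁f) (∨-lub
      (⋁-lub f λ i → ≤-trans (≤-⋁basis (f i))
        (⋁-reindex (β ∘ proj₁) λ b → proj₁ b , inj₂ (i , proj₂ b)))
      (≤-trans (≤-⋁basis (a *))
        (⋁-reindex (β ∘ proj₁) λ b → proj₁ b , inj₁ (proj₂ b))))

    subcover = compact U covers
    n = proj₁ subcover
    g = proj₁ (proj₂ subcover)

    tag : Σ[ b ∈ B ] U b → Maybe I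
    tag (_ , inj₁ _)       = nothing
    tag (_ , inj₂ (i , _)) = just i

    under-tag : ∀ s → β (proj₁ s) ≤ maybe′ f 𝟘 (tag s) ∨ a *
    under-tag (_ , inj₁ b≤a*)       = ≤-trans b≤a* y≤x∨y
    under-tag (_ , inj₂ (_ , b≤fi)) = ≤-trans b≤fi x≤x∨y

module PcdTerms (M : Locale) where
  open Locale M
  open LocaleProperties M

  infixr 7 _∧ᵗ_
  infixr 6 _∨ᵗ_

  data Term : Set where
    base      : B → Term
    𝟎 𝟏       : Term
    _∧ᵗ_ _∨ᵗ_ : Term → Term → Term
    _*ᵗ       : Term → Term

  ⟦_⟧ : Term → Carrier
  ⟦ base b ⟧  = β b
  ⟦ 𝟎 ⟧       = 𝟘
  ⟦ 𝟏 ⟧       = ⊤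
  ⟦ p ∧ᵗ q ⟧ = ⟦ p ⟧ ∧ ⟦ q ⟧
  ⟦ p ∨ᵗ q ⟧ = ⟦ p ⟧ ∨ ⟦ q ⟧
  ⟦ p *ᵗ ⟧    = ⟦ p ⟧ *

  ⋁ᵗ : ∀ n → (Fin n → Term) → Term
  ⋁ᵗ zero    t = 𝟎
  ⋁ᵗ (suc n) t = t zero ∨ᵗ ⋁ᵗ n (t ∘ suc)

  ⋁-≤-⋁ᵗ : ∀ n (t : Fin n → Term) → ⋁ (⟦_⟧ ∘ t) ≤ ⟦ ⋁ᵗ n t ⟧
  ⋁-≤-⋁ᵗ zero    t = ⋁-lub _ λ ()
  ⋁-≤-⋁ᵗ (suc n) t = ⋁-lub _ λ
    { zero    → x≤x∨y
    ; (suc i) → ≤-trans (≤-trans (⋁-ub (⟦_⟧ ∘ t ∘ suc) i) (⋁-≤-⋁ᵗ n (t ∘ suc))) y≤x∨y }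

  ⋁ᵗ-closed : (Pr : Term → Set) → Pr 𝟎 → (∀ {p q} → Pr p → Pr q → Pr (p ∨ᵗ q)) →
              ∀ n (t : Fin n → Term) → (∀ i → Pr (t i)) → Pr (⋁ᵗ n t)
  ⋁ᵗ-closed Pr Pr𝟎 Pr∨ zero    t Prt = Pr𝟎
  ⋁ᵗ-closed Pr Pr𝟎 Pr∨ (suc n) t Prt =
    Pr∨ (Prt zero) (⋁ᵗ-closed Pr Pr𝟎 Pr∨ n (t ∘ suc) (Prt ∘ suc))

  ≺-⋁-∨-closed : IsCompact M → (Pr : Term → Set) →
    Pr 𝟎 → (∀ {p q} → Pr p → Pr q → Pr (p ∨ᵗ q)) →
    ∀ {a} → a ≺ ⋁ {Σ Term Pr} (⟦_⟧ ∘ proj₁) → Σ[ q ∈ Term ] (Pr q × a ≺ ⟦ q ⟧)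
  ≺-⋁-∨-closed compact Pr Pr𝟎 Pr∨ a≺⋁ =
    ⋁ᵗ n t , ⋁ᵗ-closed Pr Pr𝟎 Pr∨ n t (Pr-term ∘ g) ,
    ≺-mono ≤-refl a≺finite (≤-trans (⋁-mono (value≤ ∘ g)) (⋁-≤-⋁ᵗ n t))
    where
    finite = compact⇒≺-⋁-finite compact (⟦_⟧ ∘ proj₁) a≺⋁
    n = proj₁ finite
    g = proj₁ (proj₂ finite)
    a≺finite = proj₂ (proj₂ finite)

    term : Maybe (Σ Term Pr) → Term
    term = maybe′ proj₁ 𝟎

    t : Fin n → Term
    t = term ∘ g

    Pr-term : ∀ m → Pr (term m)
    Pr-term (just (_ , Prq)) = Prq
    Pr-term nothing          = Pr𝟎

    value≤ : ∀ m → maybe′ (⟦_⟧ ∘ proj₁) 𝟘 m ≤ ⟦ term m ⟧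
    value≤ (just _) = ≤-refl
    value≤ nothing  = ≤-refl

  ≺-interpolate : IsCompact M → IsRegular M →
    ∀ {a y} → a ≺ y → Σ[ z ∈ Term ] ((a ≺ ⟦ z ⟧) × (⟦ z ⟧ ≺ y))
  ≺-interpolate compact regular {a} {y} a≺y
    with ≺-⋁-∨-closed compact (λ t → ⟦ t ⟧ ≺ y) 𝟘≺ ≺-∨
           (≺-mono ≤-refl a≺y (≤-trans (regular⇒≤⋁≺ regular y)
             (⋁-reindex (⟦_⟧ ∘ proj₁) λ d → base (proj₁ d) , proj₂ d)))
  ... | z , z≺y , a≺z = z , a≺z , z≺y

module Compactification (L kL : Locale) (k : Locale.B kL → Locale.Carrier L)
                        (kc : IsCompactification L kL k) where
  private
    module L = Locale L
    module K = Locale kL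
    module Lp = LocaleProperties L
    module Kp = LocaleProperties kL
  open IsCompactification kc
  open IsContinuous continuous
  open PcdTerms kL

  k[_] : K.Carrier → L.Carrier
  k[_] = pre[_] L kL k

  k[]-mono : ∀ {x y} → x K.≤ y → k[ x ] L.≤ k[ y ]
  k[]-mono x≤y = L.⋁-lub _ λ b → L.⋁-ub _ (proj₁ b , K.≤-trans (proj₂ b) x≤y)

  k-mono : ∀ {b c} → K.β b K.≤ K.β c → k b L.≤ k c
  k-mono {b} {c} b≤c = L.≤-trans
    (pres-cover b (_≡ c) (K.≤-trans b≤c (K.⋁-ub (K.β ∘ proj₁) (c , refl))))
    (L.⋁-lub _ λ { (_ , refl) → L.≤-refl })

  k≤k[β] : ∀ c → k c L.≤ k[ K.β c ]
  k≤k[β] c = L.⋁-ub _ (c , K.≤-refl)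

  k[β]≤k : ∀ c → k[ K.β c ] L.≤ k c
  k[β]≤k c = L.⋁-lub _ (k-mono ∘ proj₂)

  k[]-⋁ : ∀ {I : Set} (f : I → K.Carrier) → k[ K.⋁ f ] L.≤ L.⋁ (λ i → k[ f i ])
  k[]-⋁ {I} f = L.⋁-lub _ λ b → L.≤-trans
    (pres-cover (proj₁ b) (λ u → Σ[ i ∈ I ] (K.β u K.≤ f i))
      (K.≤-trans (proj₂ b) (K.⋁-lub f λ i → K.≤-trans (Kp.≤-⋁basis (f i))
        (Kp.⋁-reindex (K.β ∘ proj₁) λ u → proj₁ u , i , proj₂ u))))
    (Lp.⋁-≤-⋁ _ _ λ u → proj₁ (proj₂ u) , L.⋁-ub _ (proj₁ u , proj₂ (proj₂ u)))

  k[]-𝟘 : k[ K.𝟘 ] L.≈ L.𝟘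
  k[]-𝟘 = L.≤-trans (k[]-⋁ _) (L.⋁-lub _ λ ()) , Lp.𝟘-min

  k[]-⊤ : k[ K.⊤ ] L.≈ L.⊤
  k[]-⊤ = L.⊤-max , proj₂ pres-top

  k[]-∨ : ∀ {x y} → k[ x K.∨ y ] L.≈ k[ x ] L.∨ k[ y ]
  k[]-∨ = L.≤-trans (k[]-⋁ _) (L.⋁-lub _ λ { true → Lp.x≤x∨y ; false → Lp.y≤x∨y })
        , Lp.∨-lub (k[]-mono Kp.x≤x∨y) (k[]-mono Kp.y≤x∨y)

  k[]-∧ : ∀ {x y} → k[ x K.∧ y ] L.≈ k[ x ] L.∧ k[ y ]
  k[]-∧ = L.∧-glb (k[]-mono K.∧-lb₁) (k[]-mono K.∧-lb₂)
        , Lp.⋁-∧-⋁-lub _ _ λ a b → L.≤-trans (proj₁ (pres-meet (proj₁ a) (proj₁ b)))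
            (L.⋁-lub _ λ c → L.⋁-ub _ (proj₁ c ,
              K.∧-glb (K.≤-trans (proj₁ (proj₂ c)) (proj₂ a))
                      (K.≤-trans (proj₂ (proj₂ c)) (proj₂ b))))

  k[]-reflects-𝟘 : ∀ {a} → k[ a ] L.≤ L.𝟘 → a K.≤ K.𝟘
  k[]-reflects-𝟘 k[a]≤𝟘 = proj₁ (dense _ (k[a]≤𝟘 , Lp.𝟘-min))

  -- The inequality ≥ lifts each basic c ≤ k[ x ]* to kL via surjectivity of
  -- k[_], and density shows the lift is disjoint from x.
  k[]-* : ∀ {x} → k[ x K.* ] L.≈ k[ x ] L.*
  k[]-* {x} =
      Lp.∧≤𝟘⇒≤* (L.≤-trans (proj₂ k[]-∧) (L.≤-trans
        (k[]-mono (K.≤-trans Kp.∧-comm Kp.x∧x*≤𝟘)) (proj₁ k[]-𝟘)))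
    , L.⋁-lub _ λ c → let (z , k[z]≈c) = embedding (L.β (proj₁ c)) in
        L.≤-trans (proj₂ k[z]≈c) (k[]-mono (Kp.∧≤𝟘⇒≤* (k[]-reflects-𝟘
          (L.≤-trans (proj₁ k[]-∧)
            (L.≤-trans (Lp.∧-mono (proj₁ k[z]≈c) L.≤-refl) (proj₁ (proj₂ c)))))))

  k[]-≺ : ∀ {a y} → a K.≺ y → k[ a ] L.≺ k[ y ]
  k[]-≺ a≺y = Lp.⊤≤x∨y*⇒y≺x (L.≤-trans (proj₂ k[]-⊤) (L.≤-trans (k[]-mono (proj₁ a≺y))
    (L.≤-trans (proj₁ k[]-∨) (Lp.∨-mono L.≤-refl (proj₁ k[]-*)))))

  k[]-≤⇒≤** : ∀ {u a} → k[ u ] L.≤ k[ a ] → u K.≤ a K.* K.*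
  k[]-≤⇒≤** k[u]≤k[a] = Kp.∧≤𝟘⇒≤* (k[]-reflects-𝟘 (L.≤-trans (proj₁ k[]-∧)
    (L.≤-trans (Lp.∧-mono k[u]≤k[a] (proj₁ k[]-*)) Lp.x∧x*≤𝟘)))

  k[]-≤⇒≺ : ∀ {u a b} → k[ u ] L.≤ k[ a ] → a K.≺ b → u K.≺ b
  k[]-≤⇒≺ k[u]≤k[a] a≺b = Kp.≺-mono (k[]-≤⇒≤** k[u]≤k[a]) (Kp.≺-** a≺b) K.≤-refl

  k₊ : L.Carrier → K.Carrier
  k₊ y = K.⋁ {Σ[ c ∈ K.B ] (k c L.≤ y)} (K.β ∘ proj₁)

  k₊-mono : ∀ {x y} → x L.≤ y → k₊ x K.≤ k₊ y
  k₊-mono x≤y = Kp.⋁-reindex (K.β ∘ proj₁) λ c → proj₁ c , L.≤-trans (proj₂ c) x≤y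

  k₊-counit : ∀ {y} → k[ k₊ y ] L.≤ y
  k₊-counit = L.≤-trans (k[]-⋁ _) (L.⋁-lub _ λ c → L.≤-trans (k[β]≤k (proj₁ c)) (proj₂ c))

  k₊-unit : ∀ {x} → x K.≤ k₊ k[ x ]
  k₊-unit {x} = K.≤-trans (Kp.≤-⋁basis x) (Kp.⋁-reindex (K.β ∘ proj₁) λ c →
    proj₁ c , L.≤-trans (k≤k[β] (proj₁ c)) (k[]-mono (proj₂ c)))

  k₊-∧ : ∀ {y z} → k₊ y K.∧ k₊ z K.≤ k₊ (y L.∧ z)
  k₊-∧ = K.≤-trans k₊-unit (k₊-mono (L.≤-trans (proj₁ k[]-∧) (Lp.∧-mono k₊-counit k₊-counit)))

  k₊k[]≤** : ∀ {a} → k₊ k[ a ] K.≤ a K.* K.*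
  k₊k[]≤** = k[]-≤⇒≤** k₊-counit

  ι : Term → L.Carrier
  ι t = k[ ⟦ t ⟧ ]

  Pk : SubPcdLattice L
  Pk = record
    { P = Term ; ι = ι ; 0P = 𝟎 ; 1P = 𝟏 ; _∧P_ = _∧ᵗ_ ; _∨P_ = _∨ᵗ_ ; _*P = _*ᵗ
    ; ι-0 = k[]-𝟘 ; ι-1 = k[]-⊤
    ; ι-∧ = λ _ _ → k[]-∧ ; ι-∨ = λ _ _ → k[]-∨ ; ι-* = λ _ → k[]-* }

  -- Distinct terms may have the same image in L; reading the right-hand side
  -- through k₊ ∘ ι makes ◁ depend only on ι q.
  _◁_ : Term → Term → Set
  p ◁ q = ⟦ p ⟧ K.≺ k₊ (ι q)

  ◁-strongInclusion : IsStrongInclusion L Pk _◁_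
  ◁-strongInclusion = record
    { si-0 = Kp.𝟘≺
    ; si-1 = Kp.≺-mono K.≤-refl Kp.≺⊤ k₊-unit
    ; si-mono = λ x≤a a◁b b≤y → Kp.≺-mono K.≤-refl (k[]-≤⇒≺ x≤a a◁b) (k₊-mono b≤y)
    ; si-∧ = λ x◁a x◁b → Kp.≺-mono K.≤-refl (Kp.≺-∧ x◁a x◁b)
               (K.≤-trans k₊-∧ (k₊-mono (proj₂ k[]-∧)))
    ; si-∨ = Kp.≺-∨
    ; si-* = λ a◁b → Kp.≺-mono (K.≤-trans Kp.x≤x** (Kp.*-antitone k₊k[]≤**))
               (Kp.≺-* a◁b) k₊-unit
    ; si-≺ = λ a◁b → Lp.≺-mono L.≤-refl (k[]-≺ a◁b) k₊-counit
    ; si-interp = λ x◁y → let (z , x≺z , z◁y) = ≺-interpolate compact regular x◁y in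
        z , Kp.≺-mono K.≤-refl x≺z k₊-unit , z◁y }

  ◁-compatible : IsCompatible L Pk _◁_
  ◁-compatible = record
    { generates = λ x → let (a , k[a]≈x) = embedding x in
          L.≤-trans (proj₂ k[a]≈x) (L.⋁-lub _ λ c → L.≤-trans (k≤k[β] (proj₁ c))
            (L.⋁-ub (ι ∘ proj₁) (base (proj₁ c) ,
              L.≤-trans (k[]-mono (proj₂ c)) (proj₁ k[a]≈x))))
        , L.⋁-lub _ proj₂
    ; approx = λ a →
          L.≤-trans (k[]-mono (Kp.regular⇒≤⋁≺ regular ⟦ a ⟧)) (L.≤-trans (k[]-⋁ _)
            (Lp.⋁-reindex (ι ∘ proj₁) λ d →
              base (proj₁ d) , Kp.≺-mono K.≤-refl (proj₂ d) k₊-unit))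
        , L.⋁-lub _ λ x → L.≤-trans (k[]-mono (Kp.≺⇒≤ (proj₂ x))) k₊-counit }

  ≺-ideal : K.Carrier → RoundIdeal L Pk _◁_
  ≺-ideal x = record
    { I = λ p → ⟦ p ⟧ K.≺ x
    ; down = k[]-≤⇒≺
    ; has-0 = Kp.𝟘≺
    ; has-∨ = Kp.≺-∨
    ; round = λ b≺x → let (z , b≺z , z≺x) = ≺-interpolate compact regular b≺x in
        z , z≺x , Kp.≺-mono K.≤-refl b≺z k₊-unit }

  ⋁-ideal : RoundIdeal L Pk _◁_ → K.Carrier
  ⋁-ideal I = K.⋁ {Σ Term (RoundIdeal.I I)} (⟦_⟧ ∘ proj₁)

  ≺⋁-ideal⇒∈ : ∀ I p → ⟦ p ⟧ K.≺ ⋁-ideal I → RoundIdeal.I I p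
  ≺⋁-ideal⇒∈ I p p≺⋁I =
    let (q , q∈I , p≺q) = ≺-⋁-∨-closed compact (RoundIdeal.I I)
                            (RoundIdeal.has-0 I) (RoundIdeal.has-∨ I) p≺⋁I in
    RoundIdeal.down I (k[]-mono (Kp.≺⇒≤ p≺q)) q∈I

  ∈⇒≺⋁-ideal : ∀ I p → RoundIdeal.I I p → ⟦ p ⟧ K.≺ ⋁-ideal I
  ∈⇒≺⋁-ideal I p p∈I =
    let (a , a∈I , p◁a) = RoundIdeal.round I p∈I in
    Kp.≺-mono K.≤-refl p◁a (Kp.⋁-reindex (⟦_⟧ ∘ proj₁) λ c →
      base (proj₁ c) , RoundIdeal.down I (L.≤-trans (k[β]≤k (proj₁ c)) (proj₂ c)) a∈I)

  ℛ≅kL : ℛ≅ L Pk _◁_ kL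
  ℛ≅kL = record
    { to = ⋁-ideal
    ; from = ≺-ideal
    ; to-mono = λ I⊆J → Kp.⋁-reindex (⟦_⟧ ∘ proj₁) λ q → proj₁ q , I⊆J (proj₁ q) (proj₂ q)
    ; from-mono = λ x≤y _ p≺x → Kp.≺-mono K.≤-refl p≺x x≤y
    ; from-to = λ I → ≺⋁-ideal⇒∈ I , ∈⇒≺⋁-ideal I
    ; to-from = λ x → K.⋁-lub _ (Kp.≺⇒≤ ∘ proj₂)
        , K.≤-trans (Kp.regular⇒≤⋁≺ regular x)
            (Kp.⋁-reindex (⟦_⟧ ∘ proj₁) λ d → base (proj₁ d) , proj₂ d) }

theorem4p8 : (L kL : Locale) (k : Locale.B kL → Locale.Carrier L) →
    IsCompactification L kL k →
    Σ[ Pk ∈ SubPcdLattice L ] Σ[ ◁k ∈ (SubPcdLattice.P Pk → SubPcdLattice.P Pk → Set) ]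
      (IsStrongInclusion L Pk ◁k × IsCompatible L Pk ◁k × ℛ≅ L Pk ◁k kL)
theorem4p8 L kL k kc = Pk , _◁_ , ◁-strongInclusion , ◁-compatible , ℛ≅kL
  where open Compactification L kL k kc
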